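{- Let $k\ge 1$ and $0\le t\le k$ be integers. For every $n\ge 1$, the total number of down-steps following the last up-step, summed over all $k_t$-Dyck paths with $n$ up-steps, satisfies \[ s_{n,t,n}=C_{n+1,t}-(t+1)C_{n,t}. \]
   Context: A $k_t$-Dyck path is a lattice path consisting of up-steps $(1,k)$ and down-steps $(1,-1)$ that starts at $(0,0)$, stays weakly above the line $y=-t$, and ends on the line $y=0$. $s_{n,t,n}$ denotes the total number, over all $k_t$-Dyck paths with $n$ up-steps, of down-steps after the last up-step. For integers $m,j\ge 0$, $C_{m,j}=\frac{j+1}{(k+1)m+j+1}\binom{(k+1)m+j+1}{m}$. -}

module Defs where

open import Data.Nat using (ℕ; zero; suc; _+_; _*_; _/_)
open import Data.Nat.Combinatorics using (_C_)
open import Data.Integer as ℤ using (ℤ; +_; -_)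
open import Data.Integer.Properties using () renaming (_≤?_ to _≤ℤ?_; _≟_ to _≟ℤ_)
open import Data.Bool using (Bool; true; false; _∧_)
open import Data.List using (List; []; _∷_; map; concatMap; filter; reverse; length)
open import Data.Nat.ListAction using (sum)
open import Relation.Nullary.Decidable using (⌊_⌋)
open import Data.Product using (_×_; _,_)

-- Steps of a lattice path: U = up-step (1,k), D = down-step (1,-1).
data Step : Set where
  U D : Step

allSeqs : ℕ → List (List Step)
allSeqs zero = [] ∷ []
allSeqs (suc L) = concatMap (λ p → (U ∷ p) ∷ (D ∷ p) ∷ []) (allSeqs L)

ups : List Step → ℕ
ups [] = 0
ups (U ∷ p) = suc (ups p)
ups (D ∷ p) = ups p

walkOK : ℕ → ℕ → ℤ → List Step → Bool
walkOK k t h [] = ⌊ h ≟ℤ + 0 ⌋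
walkOK k t h (U ∷ p) = ⌊ (- (+ t)) ≤ℤ? (h ℤ.+ + k) ⌋ ∧ walkOK k t (h ℤ.+ + k) p
walkOK k t h (D ∷ p) = ⌊ (- (+ t)) ≤ℤ? (h ℤ.- + 1) ⌋ ∧ walkOK k t (h ℤ.- + 1) p

isKtDyck : ℕ → ℕ → List Step → Bool
isKtDyck k t p = walkOK k t (+ 0) p

hasUps : ℕ → List Step → Bool
hasUps n p = ⌊ ups p Data.Nat.≟ n ⌋

leadingDowns : List Step → ℕ
leadingDowns [] = 0
leadingDowns (D ∷ p) = suc (leadingDowns p)
leadingDowns (U ∷ p) = 0

downsAfterLastUp : List Step → ℕ
downsAfterLastUp p = leadingDowns (reverse p)

-- Such a path has exactly k*n
-- down-steps (it ends at height 0), hence length n + n * k; we enumerate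
-- all step sequences of that length and keep the k_t-Dyck ones with n ups.
ktDyckPaths : ℕ → ℕ → ℕ → List (List Step)
ktDyckPaths k t n =
  filter (λ p → Data.Bool.T? (isKtDyck k t p ∧ hasUps n p)) (allSeqs (n + n * k))

s : ℕ → ℕ → ℕ → ℕ
s k t n = sum (map downsAfterLastUp (ktDyckPaths k t n))

-- C_{m,j} = (j+1)/((k+1)m+j+1) * binom((k+1)m+j+1, m)   (an integer;
-- computed by exact division in ℕ, the denominator is nonzero)
Cmj : ℕ → ℕ → ℕ → ℕ
Cmj k m j = ((j + 1) * (suc ((k + 1) * m + j) C m)) / suc ((k + 1) * m + j)

module Submission where

-- Shift heights up by t: a k_t-Dyck path becomes a walk from height t to height t that never
-- goes below 0 (up-steps +k, down-steps -1).  The walks from a to 0 with n up-steps satisfy a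
-- first-step recurrence, by which their number is C_{n,a}: induction with Pascal's rule and the
-- absorption identity (j+1)·C(m+1,j+1) = (m+1)·C(m,j).
-- Deleting the last up-step and the down-steps after it from a walk from t to 0 with n+1 up-steps
-- leaves a walk from t to some height e ≥ 0 with n up-steps.  For e ≤ t ≤ k these are the
-- k_t-Dyck paths followed by t - e forced down-steps, which gives (t+1)·C_{n,t}; for e > t they
-- are the k_t-Dyck paths cut inside their final run of down-steps, and there are s_{n,t,n} of
-- them.  Hence C_{n+1,t} = (t+1)·C_{n,t} + s_{n,t,n}.

open import Defs

-- The ℕ operators are opened only inside this module, since the statement at the end uses ℤ's.
module _ where

  open import Algebra.Properties.CommutativeSemigroup using (interchange)
  open import Data.Bool using (Bool; true; false; _∧_; T?)
  open import Data.Bool.Properties using (∧-zeroʳ)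
  open import Data.List using (List; []; _∷_; map; concatMap; filter; _∷ʳ_)
  open import Data.List.Properties using (map-cong; reverse-++)
  open import Data.Nat using (ℕ; zero; suc; _+_; _*_; _/_; _≤_; _<_; _≟_; z≤n; s≤s)
  open import Data.Nat.Combinatorics using (_C_; nC1≡n; nCk+nC[k+1]≡[n+1]C[k+1])
  open import Data.Nat.DivMod using (m*n/n≡m)
  open import Data.Nat.ListAction using (sum)
  open import Data.Nat.Properties
  open import Data.Nat.Tactic.RingSolver using (solve)
  open import Function using (_∘_; _⇔_; mk⇔)
  open import Relation.Binary.PropositionalEquality
  open import Relation.Nullary using (¬_; Dec)
  open import Relation.Nullary.Decidable using (⌊_⌋; isYes≗does; does-⇔; dec-true; dec-false)
  open ≡-Reasoning

  ⌊⌋-⇔ : ∀ {A B : Set} → A ⇔ B → (a? : Dec A) (b? : Dec B) → ⌊ a? ⌋ ≡ ⌊ b? ⌋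
  ⌊⌋-⇔ A⇔B a? b? = trans (isYes≗does a?) (trans (does-⇔ A⇔B a? b?) (sym (isYes≗does b?)))

  ⌊⌋-true : ∀ {A : Set} → A → (a? : Dec A) → ⌊ a? ⌋ ≡ true
  ⌊⌋-true a a? = trans (isYes≗does a?) (dec-true a? a)

  ⌊⌋-false : ∀ {A : Set} → ¬ A → (a? : Dec A) → ⌊ a? ⌋ ≡ false
  ⌊⌋-false ¬a a? = trans (isYes≗does a?) (dec-false a? ¬a)

  ≟-suc : ∀ m n → ⌊ suc m ≟ suc n ⌋ ≡ ⌊ m ≟ n ⌋
  ≟-suc m n = ⌊⌋-⇔ (mk⇔ suc-injective (cong suc)) (suc m ≟ suc n) (m ≟ n)

  ≟-+ʳ : ∀ k m n → ⌊ m + k ≟ n + k ⌋ ≡ ⌊ m ≟ n ⌋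
  ≟-+ʳ k m n = ⌊⌋-⇔ (mk⇔ (+-cancelʳ-≡ k m n) (cong (_+ k))) (m + k ≟ n + k) (m ≟ n)

  𝟙 : Bool → ℕ
  𝟙 true = 1
  𝟙 false = 0

  𝟙-∧-cong : ∀ {b b′ c c′} → b ≡ b′ → c ≡ c′ → 𝟙 (b ∧ c) ≡ 𝟙 (b′ ∧ c′)
  𝟙-∧-cong = cong₂ (λ b c → 𝟙 (b ∧ c))

  module _ {A : Set} where

    sum-map-+ : ∀ (f g : A → ℕ) xs →
      sum (map (λ x → f x + g x) xs) ≡ sum (map f xs) + sum (map g xs)
    sum-map-+ f g [] = refl
    sum-map-+ f g (x ∷ xs) = trans (cong (f x + g x +_) (sum-map-+ f g xs))
      (interchange +-commutativeSemigroup (f x) (g x) _ _)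

    sum-map-zero : ∀ {f : A → ℕ} → (∀ x → f x ≡ 0) → ∀ xs → sum (map f xs) ≡ 0
    sum-map-zero f≗0 [] = refl
    sum-map-zero f≗0 (x ∷ xs) = cong₂ _+_ (f≗0 x) (sum-map-zero f≗0 xs)

    sum-map-filter : ∀ (b : A → Bool) (f : A → ℕ) xs →
      sum (map f (filter (T? ∘ b) xs)) ≡ sum (map (λ x → 𝟙 (b x) * f x) xs)
    sum-map-filter b f [] = refl
    sum-map-filter b f (x ∷ xs) with b x
    ... | true = cong₂ _+_ (sym (+-identityʳ (f x))) (sum-map-filter b f xs)
    ... | false = sum-map-filter b f xs

  Σseq : ℕ → (List Step → ℕ) → ℕ
  Σseq L f = sum (map f (allSeqs L))

  Σseq-cong : ∀ L {f g : List Step → ℕ} → (∀ p → f p ≡ g p) → Σseq L f ≡ Σseq L g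
  Σseq-cong L f≗g = cong sum (map-cong f≗g (allSeqs L))

  Σseq-zero : ∀ L {f : List Step → ℕ} → (∀ p → f p ≡ 0) → Σseq L f ≡ 0
  Σseq-zero L f≗0 = sum-map-zero f≗0 (allSeqs L)

  Σseq-+ : ∀ L (f g : List Step → ℕ) → Σseq L (λ p → f p + g p) ≡ Σseq L f + Σseq L g
  Σseq-+ L f g = sum-map-+ f g (allSeqs L)

  Σseq-∷ : ∀ L f → Σseq (suc L) f ≡ Σseq L (f ∘ (U ∷_)) + Σseq L (f ∘ (D ∷_))
  Σseq-∷ L f = trans (prepend (allSeqs L)) (Σseq-+ L (f ∘ (U ∷_)) (f ∘ (D ∷_)))
    where
    prepend : ∀ ps → sum (map f (concatMap (λ p → (U ∷ p) ∷ (D ∷ p) ∷ []) ps))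
                   ≡ sum (map (λ p → f (U ∷ p) + f (D ∷ p)) ps)
    prepend [] = refl
    prepend (p ∷ ps) = trans (sym (+-assoc (f (U ∷ p)) (f (D ∷ p)) _))
      (cong (f (U ∷ p) + f (D ∷ p) +_) (prepend ps))

  Σseq-∷ʳ : ∀ L f → Σseq (suc L) f ≡ Σseq L (f ∘ (_∷ʳ U)) + Σseq L (f ∘ (_∷ʳ D))
  Σseq-∷ʳ zero f = Σseq-∷ zero f
  Σseq-∷ʳ (suc L) f = begin
    Σseq (suc (suc L)) f
      ≡⟨ Σseq-∷ (suc L) f ⟩
    Σseq (suc L) (f ∘ (U ∷_)) + Σseq (suc L) (f ∘ (D ∷_))
      ≡⟨ cong₂ _+_ (Σseq-∷ʳ L (f ∘ (U ∷_))) (Σseq-∷ʳ L (f ∘ (D ∷_))) ⟩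
    (UU + UD) + (DU + DD)
      ≡⟨ interchange +-commutativeSemigroup UU UD DU DD ⟩
    (UU + DU) + (UD + DD)
      ≡⟨ sym (cong₂ _+_ (Σseq-∷ L (f ∘ (_∷ʳ U))) (Σseq-∷ L (f ∘ (_∷ʳ D)))) ⟩
    Σseq (suc L) (f ∘ (_∷ʳ U)) + Σseq (suc L) (f ∘ (_∷ʳ D)) ∎
    where
    UU UD DU DD : ℕ
    UU = Σseq L (λ p → f (U ∷ p ∷ʳ U))
    UD = Σseq L (λ p → f (U ∷ p ∷ʳ D))
    DU = Σseq L (λ p → f (D ∷ p ∷ʳ U))
    DD = Σseq L (λ p → f (D ∷ p ∷ʳ D))

  ups-∷ʳU : ∀ p → ups (p ∷ʳ U) ≡ suc (ups p)
  ups-∷ʳU [] = refl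
  ups-∷ʳU (U ∷ p) = cong suc (ups-∷ʳU p)
  ups-∷ʳU (D ∷ p) = ups-∷ʳU p

  ups-∷ʳD : ∀ p → ups (p ∷ʳ D) ≡ ups p
  ups-∷ʳD [] = refl
  ups-∷ʳD (U ∷ p) = cong suc (ups-∷ʳD p)
  ups-∷ʳD (D ∷ p) = ups-∷ʳD p

  downsAfterLastUp-∷ʳU : ∀ p → downsAfterLastUp (p ∷ʳ U) ≡ 0
  downsAfterLastUp-∷ʳU p = cong leadingDowns (reverse-++ p (U ∷ []))

  downsAfterLastUp-∷ʳD : ∀ p → downsAfterLastUp (p ∷ʳ D) ≡ suc (downsAfterLastUp p)
  downsAfterLastUp-∷ʳD p = cong leadingDowns (reverse-++ p (D ∷ []))

  -- Heights are measured from the floor, so the k_t-Dyck paths are the walks from t to t.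
  isWalk : ℕ → ℕ → ℕ → List Step → Bool
  isWalk k a e [] = ⌊ a ≟ e ⌋
  isWalk k a e (U ∷ p) = isWalk k (a + k) e p
  isWalk k zero e (D ∷ p) = false
  isWalk k (suc a) e (D ∷ p) = isWalk k a e p

  walks : ℕ → ℕ → ℕ → ℕ → ℕ → ℕ
  walks k L a e n = Σseq L (λ p → 𝟙 (isWalk k a e p ∧ hasUps n p))

  trailingDowns : ℕ → ℕ → ℕ → ℕ → ℕ → ℕ
  trailingDowns k L a e n =
    Σseq L (λ p → 𝟙 (isWalk k a e p ∧ hasUps n p) * downsAfterLastUp p)

  hasUps-U∷ : ∀ n p → hasUps (suc n) (U ∷ p) ≡ hasUps n p
  hasUps-U∷ n p = ≟-suc (ups p) n

  hasUps-∷ʳU : ∀ n p → hasUps (suc n) (p ∷ʳ U) ≡ hasUps n p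
  hasUps-∷ʳU n p = trans (cong (λ u → ⌊ u ≟ suc n ⌋) (ups-∷ʳU p)) (≟-suc (ups p) n)

  hasUps-∷ʳD : ∀ n p → hasUps n (p ∷ʳ D) ≡ hasUps n p
  hasUps-∷ʳD n p = cong (λ u → ⌊ u ≟ n ⌋) (ups-∷ʳD p)

  -- The walks from height a to 0 with n up-steps, counted by their first step (walks-ballot).
  ballot : ℕ → ℕ → ℕ → ℕ
  ballot k a zero = 1
  ballot k zero (suc n) = ballot k k n
  ballot k (suc a) (suc n) = ballot k (suc a + k) n + ballot k a (suc n)

  module _ (k : ℕ) where

    isWalk-∷ʳU : ∀ a e p → isWalk k a (e + k) (p ∷ʳ U) ≡ isWalk k a e p
    isWalk-∷ʳU a e [] = ≟-+ʳ k a e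
    isWalk-∷ʳU a e (U ∷ p) = isWalk-∷ʳU (a + k) e p
    isWalk-∷ʳU zero e (D ∷ p) = refl
    isWalk-∷ʳU (suc a) e (D ∷ p) = isWalk-∷ʳU a e p

    isWalk-∷ʳU-below : ∀ a {e} p → e < k → isWalk k a e (p ∷ʳ U) ≡ false
    isWalk-∷ʳU-below a {e} [] e<k =
      ⌊⌋-false (λ a+k≡e → <⇒≱ e<k (subst (k ≤_) a+k≡e (m≤n+m k a))) (a + k ≟ e)
    isWalk-∷ʳU-below a (U ∷ p) e<k = isWalk-∷ʳU-below (a + k) p e<k
    isWalk-∷ʳU-below zero (D ∷ p) e<k = refl
    isWalk-∷ʳU-below (suc a) (D ∷ p) e<k = isWalk-∷ʳU-below a p e<k

    isWalk-∷ʳD : ∀ a e p → isWalk k a e (p ∷ʳ D) ≡ isWalk k a (suc e) p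
    isWalk-∷ʳD zero e [] = refl
    isWalk-∷ʳD (suc a) e [] = sym (≟-suc a e)
    isWalk-∷ʳD a e (U ∷ p) = isWalk-∷ʳD (a + k) e p
    isWalk-∷ʳD zero e (D ∷ p) = refl
    isWalk-∷ʳD (suc a) e (D ∷ p) = isWalk-∷ʳD a e p

    walks-zeroUps : ∀ L a e → walks k (suc L) (suc a) e 0 ≡ walks k L a e 0
    walks-zeroUps L a e = trans (Σseq-∷ L _)
      (cong (_+ walks k L a e 0) (Σseq-zero L (λ p → cong 𝟙 (∧-zeroʳ _))))

    walks-fromFloor : ∀ L e n → walks k (suc L) 0 e (suc n) ≡ walks k L k e n
    walks-fromFloor L e n = trans (Σseq-∷ L _) (trans
      (cong₂ _+_ (Σseq-cong L (λ p → 𝟙-∧-cong refl (hasUps-U∷ n p)))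
                 (Σseq-zero L (λ _ → refl)))
      (+-identityʳ _))

    walks-firstStep : ∀ L a e n →
      walks k (suc L) (suc a) e (suc n) ≡ walks k L (suc a + k) e n + walks k L a e (suc n)
    walks-firstStep L a e n = trans (Σseq-∷ L _)
      (cong (_+ walks k L a e (suc n))
        (Σseq-cong L (λ p → 𝟙-∧-cong refl (hasUps-U∷ n p))))

    walks-lastStep-below : ∀ L a e n → e < k → walks k (suc L) a e n ≡ walks k L a (suc e) n
    walks-lastStep-below L a e n e<k = trans (Σseq-∷ʳ L _) (cong₂ _+_
      (Σseq-zero L (λ p → 𝟙-∧-cong (isWalk-∷ʳU-below a p e<k) refl))
      (Σseq-cong L (λ p → 𝟙-∧-cong (isWalk-∷ʳD a e p) (hasUps-∷ʳD n p))))

    walks-lastStep : ∀ L a e n →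
      walks k (suc L) a (e + k) (suc n) ≡ walks k L a e n + walks k L a (suc (e + k)) (suc n)
    walks-lastStep L a e n = trans (Σseq-∷ʳ L _) (cong₂ _+_
      (Σseq-cong L (λ p → 𝟙-∧-cong (isWalk-∷ʳU a e p) (hasUps-∷ʳU n p)))
      (Σseq-cong L (λ p → 𝟙-∧-cong (isWalk-∷ʳD a (e + k) p) (hasUps-∷ʳD (suc n) p))))

    trailingDowns-lastStep : ∀ L a e n →
      trailingDowns k (suc L) a e n ≡ walks k L a (suc e) n + trailingDowns k L a (suc e) n
    trailingDowns-lastStep L a e n = begin
      Σseq (suc L) weighted
        ≡⟨ Σseq-∷ʳ L weighted ⟩
      Σseq L (weighted ∘ (_∷ʳ U)) + Σseq L (weighted ∘ (_∷ʳ D))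
        ≡⟨ cong₂ _+_ (Σseq-zero L endsUp) (Σseq-cong L endsDown) ⟩
      Σseq L (λ p → counted p + counted p * downsAfterLastUp p)
        ≡⟨ Σseq-+ L counted (λ p → counted p * downsAfterLastUp p) ⟩
      walks k L a (suc e) n + trailingDowns k L a (suc e) n ∎
      where
      weighted counted : List Step → ℕ
      weighted p = 𝟙 (isWalk k a e p ∧ hasUps n p) * downsAfterLastUp p
      counted p = 𝟙 (isWalk k a (suc e) p ∧ hasUps n p)
      endsUp : ∀ p → weighted (p ∷ʳ U) ≡ 0
      endsUp p = trans (cong (indicator *_) (downsAfterLastUp-∷ʳU p)) (*-zeroʳ indicator)
        where
        indicator : ℕ
        indicator = 𝟙 (isWalk k a e (p ∷ʳ U) ∧ hasUps n (p ∷ʳ U))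
      endsDown : ∀ p → weighted (p ∷ʳ D) ≡ counted p + counted p * downsAfterLastUp p
      endsDown p = begin
        weighted (p ∷ʳ D)
          ≡⟨ cong (_* downsAfterLastUp (p ∷ʳ D)) (𝟙-∧-cong (isWalk-∷ʳD a e p) (hasUps-∷ʳD n p)) ⟩
        counted p * downsAfterLastUp (p ∷ʳ D)
          ≡⟨ cong (counted p *_) (downsAfterLastUp-∷ʳD p) ⟩
        counted p * suc (downsAfterLastUp p)
          ≡⟨ *-suc (counted p) _ ⟩
        counted p + counted p * downsAfterLastUp p ∎

    walks-forcedDescent : ∀ i L a j n → j + i ≤ k → walks k (i + L) a j n ≡ walks k L a (j + i) n
    walks-forcedDescent zero L a j n _ = cong (λ e → walks k L a e n) (sym (+-identityʳ j))
    walks-forcedDescent (suc i) L a j n j+1+i≤k = begin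
      walks k (suc (i + L)) a j n
        ≡⟨ walks-lastStep-below (i + L) a j n (≤-trans (m<m+n j (s≤s z≤n)) j+1+i≤k) ⟩
      walks k (i + L) a (suc j) n
        ≡⟨ walks-forcedDescent i L a (suc j) n (subst (_≤ k) (+-suc j i) j+1+i≤k) ⟩
      walks k L a (suc j + i) n
        ≡⟨ cong (λ e → walks k L a e n) (sym (+-suc j i)) ⟩
      walks k L a (j + suc i) n ∎

    -- Turning one of the d final down-steps of a walk to e into an up-step gives a walk to
    -- e + 1 + k, and every such walk arises exactly once.
    walks≡trailingDowns : ∀ L a e n → walks k L a (suc e + k) (suc n) ≡ trailingDowns k L a e n
    walks≡trailingDowns zero a e n = cong (_+ 0) (trans
      (cong 𝟙 (∧-zeroʳ (isWalk k a (suc e + k) [])))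
      (sym (*-zeroʳ (𝟙 (isWalk k a e [] ∧ hasUps n [])))))
    walks≡trailingDowns (suc L) a e n = begin
      walks k (suc L) a (suc e + k) (suc n)
        ≡⟨ walks-lastStep L a (suc e) n ⟩
      walks k L a (suc e) n + walks k L a (suc (suc e) + k) (suc n)
        ≡⟨ cong (walks k L a (suc e) n +_) (walks≡trailingDowns L a (suc e) n) ⟩
      walks k L a (suc e) n + trailingDowns k L a (suc e) n
        ≡⟨ sym (trailingDowns-lastStep L a e n) ⟩
      trailingDowns k (suc L) a e n ∎

    walks-byLastUp : ∀ i m L a n → m + i ≤ k →
      walks k (suc i + L) a (m + k) (suc n)
        ≡ suc i * walks k L a (m + i) n + trailingDowns k L a (m + i) n
    walks-byLastUp zero m L a n _ rewrite +-identityʳ m = begin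
      walks k (suc L) a (m + k) (suc n)
        ≡⟨ walks-lastStep L a m n ⟩
      walks k L a m n + walks k L a (suc m + k) (suc n)
        ≡⟨ cong₂ _+_ (sym (+-identityʳ _)) (walks≡trailingDowns L a m n) ⟩
      1 * walks k L a m n + trailingDowns k L a m n ∎
    walks-byLastUp (suc i) m L a n m+1+i≤k = begin
      walks k (suc (suc i + L)) a (m + k) (suc n)
        ≡⟨ walks-lastStep (suc i + L) a m n ⟩
      walks k (suc i + L) a m n + walks k (suc i + L) a (suc m + k) (suc n)
        ≡⟨ cong₂ _+_ (walks-forcedDescent (suc i) L a m n m+1+i≤k)
                     (walks-byLastUp i (suc m) L a n (subst (_≤ k) (+-suc m i) m+1+i≤k)) ⟩
      walks k L a (m + suc i) n
        + (suc i * walks k L a (suc m + i) n + trailingDowns k L a (suc m + i) n)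
        ≡⟨ cong (λ e → walks k L a (m + suc i) n + (suc i * walks k L a e n + trailingDowns k L a e n))
                (sym (+-suc m i)) ⟩
      W + (suc i * W + trailingDowns k L a (m + suc i) n)
        ≡⟨ sym (+-assoc W (suc i * W) _) ⟩
      suc (suc i) * W + trailingDowns k L a (m + suc i) n ∎
      where
      W : ℕ
      W = walks k L a (m + suc i) n

    walks-ballot : ∀ a n L → L ≡ a + (n + n * k) → walks k L a 0 n ≡ ballot k a n
    walks-ballot zero zero _ refl = refl
    walks-ballot (suc a) zero _ refl =
      trans (walks-zeroUps (a + 0) a 0) (walks-ballot a zero (a + 0) refl)
    walks-ballot zero (suc n) _ refl =
      trans (walks-fromFloor (n + suc n * k) 0 n) (walks-ballot k n (n + suc n * k) (solve (n ∷ k ∷ [])))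
    walks-ballot (suc a) (suc n) _ refl = trans (walks-firstStep (a + (suc n + suc n * k)) a 0 n)
      (cong₂ _+_ (walks-ballot (suc a + k) n (a + (suc n + suc n * k)) (solve (a ∷ n ∷ k ∷ [])))
                 (walks-ballot a (suc n) (a + (suc n + suc n * k)) refl))

    ballot≡walks : ∀ t n → t ≤ k → ballot k t n ≡ walks k (n + n * k) t t n
    ballot≡walks t n t≤k = trans (sym (walks-ballot t n (t + (n + n * k)) refl))
                                 (walks-forcedDescent t (n + n * k) t 0 n t≤k)

    ballot-suc : ∀ t n → t ≤ k →
      ballot k t (suc n) ≡ suc t * ballot k t n + trailingDowns k (n + n * k) t t n
    ballot-suc t n t≤k = begin
      ballot k t (suc n)
        ≡⟨ sym (walks-ballot t (suc n) (k + (suc t + (n + n * k))) (solve (k ∷ t ∷ n ∷ []))) ⟩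
      walks k (k + (suc t + (n + n * k))) t 0 (suc n)
        ≡⟨ walks-forcedDescent k (suc t + (n + n * k)) t 0 (suc n) ≤-refl ⟩
      walks k (suc t + (n + n * k)) t k (suc n)
        ≡⟨ walks-byLastUp t 0 (n + n * k) t n t≤k ⟩
      suc t * walks k (n + n * k) t t n + trailingDowns k (n + n * k) t t n
        ≡⟨ cong (λ w → suc t * w + trailingDowns k (n + n * k) t t n)
                (sym (ballot≡walks t n t≤k)) ⟩
      suc t * ballot k t n + trailingDowns k (n + n * k) t t n ∎

  [k+1]*[n+1]C[k+1]≡[n+1]*nCk : ∀ n k → suc k * (suc n C suc k) ≡ suc n * (n C k)
  [k+1]*[n+1]C[k+1]≡[n+1]*nCk zero zero = refl
  [k+1]*[n+1]C[k+1]≡[n+1]*nCk zero (suc k) = *-zeroʳ (suc (suc k))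
  [k+1]*[n+1]C[k+1]≡[n+1]*nCk (suc n) zero =
    trans (+-identityʳ _) (trans (nC1≡n (suc (suc n))) (sym (*-identityʳ _)))
  [k+1]*[n+1]C[k+1]≡[n+1]*nCk (suc n) (suc k) = begin
    suc (suc k) * (suc (suc n) C suc (suc k))
      ≡⟨ cong (suc (suc k) *_) (sym (nCk+nC[k+1]≡[n+1]C[k+1] (suc n) (suc k))) ⟩
    suc (suc k) * (suc n C suc k + suc n C suc (suc k))
      ≡⟨ *-distribˡ-+ (suc (suc k)) (suc n C suc k) _ ⟩
    suc n C suc k + suc k * (suc n C suc k) + suc (suc k) * (suc n C suc (suc k))
      ≡⟨ cong₂ (λ x y → suc n C suc k + x + y)
               ([k+1]*[n+1]C[k+1]≡[n+1]*nCk n k) ([k+1]*[n+1]C[k+1]≡[n+1]*nCk n (suc k)) ⟩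
    suc n C suc k + suc n * (n C k) + suc n * (n C suc k)
      ≡⟨ +-assoc (suc n C suc k) _ _ ⟩
    suc n C suc k + (suc n * (n C k) + suc n * (n C suc k))
      ≡⟨ cong (suc n C suc k +_) (sym (*-distribˡ-+ (suc n) (n C k) _)) ⟩
    suc n C suc k + suc n * (n C k + n C suc k)
      ≡⟨ cong (λ x → suc n C suc k + suc n * x) (nCk+nC[k+1]≡[n+1]C[k+1] n k) ⟩
    suc (suc n) * (suc n C suc k) ∎

  [n+1]*[n+c]C[n+1]≡c*[n+c]Cn : ∀ n c → suc n * ((n + c) C suc n) ≡ c * ((n + c) C n)
  [n+1]*[n+c]C[n+1]≡c*[n+c]Cn n c = +-cancelˡ-≡ (suc n * ((n + c) C n)) _ _ (begin
    suc n * ((n + c) C n) + suc n * ((n + c) C suc n)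
      ≡⟨ sym (*-distribˡ-+ (suc n) ((n + c) C n) _) ⟩
    suc n * ((n + c) C n + (n + c) C suc n)
      ≡⟨ cong (suc n *_) (nCk+nC[k+1]≡[n+1]C[k+1] (n + c) n) ⟩
    suc n * (suc (n + c) C suc n)
      ≡⟨ [k+1]*[n+1]C[k+1]≡[n+1]*nCk (n + c) n ⟩
    (suc n + c) * ((n + c) C n)
      ≡⟨ *-distribʳ-+ ((n + c) C n) (suc n) c ⟩
    suc n * ((n + c) C n) + c * ((n + c) C n) ∎)

  ballot-closedForm-floorStep : ∀ k n X →
    X * ((k + 1) * suc n) ≡ (k + 1) * (((k + 1) * suc n) C n) →
    X * suc ((k + 1) * suc n) ≡ 1 * (suc ((k + 1) * suc n) C suc n)
  ballot-closedForm-floorStep k n X hX = *-cancelˡ-≡ _ _ (suc n) (begin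
    suc n * (X * suc ((k + 1) * suc n)) ≡⟨ solve (k ∷ n ∷ X ∷ []) ⟩
    suc ((k + 1) * suc n) * (X * suc n) ≡⟨ cong (suc N *_) X*[n+1]≡NCn ⟩
    suc N * (N C n)                     ≡⟨ sym ([k+1]*[n+1]C[k+1]≡[n+1]*nCk N n) ⟩
    suc n * (suc N C suc n)             ≡⟨ cong (suc n *_) (sym (+-identityʳ _)) ⟩
    suc n * (1 * (suc N C suc n))       ∎)
    where
    N : ℕ
    N = (k + 1) * suc n
    X*[n+1]≡NCn : X * suc n ≡ N C n
    X*[n+1]≡NCn = *-cancelˡ-≡ _ _ (suc k) (begin
      suc k * (X * suc n)   ≡⟨ solve (k ∷ n ∷ X ∷ []) ⟩
      X * ((k + 1) * suc n) ≡⟨ hX ⟩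
      (k + 1) * (N C n)     ≡⟨ cong (_* (N C n)) (+-comm k 1) ⟩
      suc k * (N C n)       ∎)

  ballot-closedForm-polynomial : ∀ k a n M C → M ≡ n + (k * suc n + suc a) →
    suc n * suc (suc M) * ((suc a + k + 1) * C)
      + suc (suc M) * (a + 1) * ((k * suc n + suc (suc a)) * C)
    ≡ suc M * (suc a + 1) * (suc n * C + (k * suc n + suc (suc a)) * C)
  ballot-closedForm-polynomial k a n _ C refl = solve (k ∷ a ∷ n ∷ C ∷ [])

  -- Multiply by (n+1)(M+1) and eliminate C₁ by the first hypothesis: a polynomial identity remains.
  ballot-closedForm-step : ∀ k a n M X Y {C₀ C₁} → M ≡ n + (k * suc n + suc a) →
    suc n * C₁ ≡ (k * suc n + suc (suc a)) * C₀ →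
    X * suc M ≡ (suc a + k + 1) * C₀ →
    Y * suc M ≡ (a + 1) * C₁ →
    (X + Y) * suc (suc M) ≡ (suc a + 1) * (C₀ + C₁)
  ballot-closedForm-step k a n M X Y {C₀} {C₁} M≡ ratio hX hY = *-cancelˡ-≡ _ _ (suc n * suc M) (begin
    suc n * suc M * ((X + Y) * suc (suc M))
      ≡⟨ solve (n ∷ M ∷ X ∷ Y ∷ []) ⟩
    suc n * suc (suc M) * (X * suc M) + suc (suc M) * suc n * (Y * suc M)
      ≡⟨ cong₂ (λ x y → suc n * suc (suc M) * x + suc (suc M) * suc n * y) hX hY ⟩
    suc n * suc (suc M) * ((suc a + k + 1) * C₀) + suc (suc M) * suc n * ((a + 1) * C₁)
      ≡⟨ solve (n ∷ M ∷ a ∷ k ∷ C₀ ∷ C₁ ∷ []) ⟩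
    suc n * suc (suc M) * ((suc a + k + 1) * C₀) + suc (suc M) * (a + 1) * (suc n * C₁)
      ≡⟨ cong (λ z → suc n * suc (suc M) * ((suc a + k + 1) * C₀) + suc (suc M) * (a + 1) * z)
              ratio ⟩
    suc n * suc (suc M) * ((suc a + k + 1) * C₀)
      + suc (suc M) * (a + 1) * ((k * suc n + suc (suc a)) * C₀)
      ≡⟨ ballot-closedForm-polynomial k a n M C₀ M≡ ⟩
    suc M * (suc a + 1) * (suc n * C₀ + (k * suc n + suc (suc a)) * C₀)
      ≡⟨ cong (λ z → suc M * (suc a + 1) * (suc n * C₀ + z)) (sym ratio) ⟩
    suc M * (suc a + 1) * (suc n * C₀ + suc n * C₁)
      ≡⟨ solve (n ∷ M ∷ a ∷ C₀ ∷ C₁ ∷ []) ⟩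
    suc n * suc M * ((suc a + 1) * (C₀ + C₁)) ∎)

  ballot-closedForm : ∀ k a n N → N ≡ suc ((k + 1) * n + a) → ballot k a n * N ≡ (a + 1) * (N C n)
  ballot-closedForm k a zero _ refl = solve (k ∷ a ∷ [])
  ballot-closedForm k zero (suc n) N N≡ rewrite trans N≡ (cong suc (+-identityʳ ((k + 1) * suc n))) =
    ballot-closedForm-floorStep k n (ballot k k n)
      (ballot-closedForm k k n ((k + 1) * suc n) (solve (k ∷ n ∷ [])))
  ballot-closedForm k (suc a) (suc n) N N≡ =
    subst (λ N → ballot k (suc a) (suc n) * N ≡ (suc a + 1) * (N C suc n)) (sym (trans N≡ N-split))
          (trans (ballot-closedForm-step k a n M (ballot k (suc a + k) n) (ballot k a (suc n)) refl ratio
                    (ballot-closedForm k (suc a + k) n (suc M) M-up)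
                    (ballot-closedForm k a (suc n) (suc M) M-down))
                 (cong ((suc a + 1) *_) (nCk+nC[k+1]≡[n+1]C[k+1] (suc M) n)))
    where
    M : ℕ
    M = n + (k * suc n + suc a)
    N-split : suc ((k + 1) * suc n + suc a) ≡ suc (suc (n + (k * suc n + suc a)))
    N-split = solve (k ∷ a ∷ n ∷ [])
    M-up : suc (n + (k * suc n + suc a)) ≡ suc ((k + 1) * n + (suc a + k))
    M-up = solve (k ∷ a ∷ n ∷ [])
    M-down : suc (n + (k * suc n + suc a)) ≡ suc ((k + 1) * suc n + a)
    M-down = solve (k ∷ a ∷ n ∷ [])
    ratio : suc n * (suc M C suc n) ≡ (k * suc n + suc (suc a)) * (suc M C n)
    ratio = subst (λ m → suc n * (m C suc n) ≡ (k * suc n + suc (suc a)) * (m C n))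
                  (sym (trans (sym (+-suc n _)) (cong (n +_) (sym (+-suc (k * suc n) (suc a))))))
                  ([n+1]*[n+c]C[n+1]≡c*[n+c]Cn n (k * suc n + suc (suc a)))

  Cmj≡ballot : ∀ k m j → Cmj k m j ≡ ballot k j m
  Cmj≡ballot k m j = trans
    (cong (_/ suc ((k + 1) * m + j)) (sym (ballot-closedForm k j m (suc ((k + 1) * m + j)) refl)))
    (m*n/n≡m (ballot k j m) (suc ((k + 1) * m + j)))


open import Data.Bool using (_∧_)
open import Data.Integer as ℤ using (+_; -_; _-_; _*_; +<+)
open import Data.Integer.Properties
  using (i≤j+i; <⇒≱; neg-mono-<; +-injective; i-j≡0⇒i≡j; i≡j⇒i-j≡0; +-inverseʳ; pos-+; pos-*;
         [+m]-[+n]≡m⊖n; ⊖-≥)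
  renaming (_≤?_ to _≤ℤ?_)
import Data.Integer.Tactic.RingSolver as ℤ-Solver
open import Data.List using ([]; _∷_)
open import Data.Nat as ℕ using (ℕ; zero; suc; _+_; _≤_; _≟_)
open import Data.Nat.Properties using (n<1+n; m≤m+n; m+n∸m≡n)
open import Function using (_∘_; mk⇔)
open import Relation.Binary.PropositionalEquality
open import Relation.Nullary using (¬_)
open ≡-Reasoning

private
  [0-i]-1≡-[1+i] : ∀ i → (+ 0 - i) - + 1 ≡ - (+ 1 ℤ.+ i)
  [0-i]-1≡-[1+i] = ℤ-Solver.solve-∀

  [i-j]+k≡[i+k]-j : ∀ i j k → (i - j) ℤ.+ k ≡ (i ℤ.+ k) - j
  [i-j]+k≡[i+k]-j = ℤ-Solver.solve-∀

  [1+i-j]-1≡i-j : ∀ i j → ((+ 1 ℤ.+ i) - j) - + 1 ≡ i - j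
  [1+i-j]-1≡i-j = ℤ-Solver.solve-∀

module _ (k t : ℕ) where

  private
    floor≤ : ∀ b → - + t ℤ.≤ + b - + t
    floor≤ b = i≤j+i (- + t) (+ b)

    floor≰ : ¬ (- + t ℤ.≤ (+ 0 - + t) - + 1)
    floor≰ = subst (λ h → ¬ (- + t ℤ.≤ h)) (sym ([0-i]-1≡-[1+i] (+ t)))
                   (<⇒≱ (neg-mono-< (+<+ (n<1+n t))))

    height-U : ∀ a → (+ a - + t) ℤ.+ + k ≡ + (a + k) - + t
    height-U a = trans ([i-j]+k≡[i+k]-j (+ a) (+ t) (+ k)) (cong (_- + t) (sym (pos-+ a k)))

    height-D : ∀ a → (+ suc a - + t) - + 1 ≡ + a - + t
    height-D a = [1+i-j]-1≡i-j (+ a) (+ t)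

  walkOK≡isWalk : ∀ a p → walkOK k t (+ a - + t) p ≡ isWalk k a t p
  walkOK≡isWalk a [] =
    ⌊⌋-⇔ (mk⇔ (+-injective ∘ i-j≡0⇒i≡j (+ a) (+ t)) (λ a≡t → i≡j⇒i-j≡0 (cong +_ a≡t)))
         _ (a ≟ t)
  walkOK≡isWalk a (U ∷ p)
    rewrite height-U a | ⌊⌋-true (floor≤ (a + k)) (- + t ≤ℤ? (+ (a + k) - + t))
    = walkOK≡isWalk (a + k) p
  walkOK≡isWalk zero (D ∷ p)
    rewrite ⌊⌋-false floor≰ (- + t ≤ℤ? ((+ 0 - + t) - + 1))
    = refl
  walkOK≡isWalk (suc a) (D ∷ p)
    rewrite height-D a | ⌊⌋-true (floor≤ a) (- + t ≤ℤ? (+ a - + t))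
    = walkOK≡isWalk a p

s≡trailingDowns : ∀ k t n → s k t n ≡ trailingDowns k (n + n ℕ.* k) t t n
s≡trailingDowns k t n = trans
  (sum-map-filter (λ p → isKtDyck k t p ∧ hasUps n p) downsAfterLastUp (allSeqs (n + n ℕ.* k)))
  (Σseq-cong (n + n ℕ.* k) (λ p →
    cong (λ b → 𝟙 (b ∧ hasUps n p) ℕ.* downsAfterLastUp p)
         (trans (cong (λ h → walkOK k t h p) (sym (+-inverseʳ (+ t)))) (walkOK≡isWalk k t t p))))

+[m+n]-+m≡+n : ∀ m n → + (m + n) - + m ≡ + n
+[m+n]-+m≡+n m n = begin
  + (m + n) - + m   ≡⟨ [+m]-[+n]≡m⊖n (m + n) m ⟩
  (m + n) ℤ.⊖ m     ≡⟨ ⊖-≥ (m≤m+n m n) ⟩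
  + ((m + n) ℕ.∸ m) ≡⟨ cong +_ (m+n∸m≡n m n) ⟩
  + n               ∎

proposition3p10 : (k t n : ℕ) → 1 ≤ k → t ≤ k → 1 ≤ n →
    + (s k t n) ≡ + (Cmj k (suc n) t) - + (suc t) * + (Cmj k n t)
proposition3p10 k t n _ t≤k _ = sym (begin
  + Cmj k (suc n) t - + suc t * + Cmj k n t
    ≡⟨ cong₂ (λ x y → + x - + suc t * + y) (Cmj≡ballot k (suc n) t) (Cmj≡ballot k n t) ⟩
  + ballot k t (suc n) - + suc t * + ballot k t n
    ≡⟨ cong₂ _-_ (cong +_ (ballot-suc k t n t≤k)) (sym (pos-* (suc t) (ballot k t n))) ⟩
  + (suc t ℕ.* ballot k t n + T) - + (suc t ℕ.* ballot k t n)
    ≡⟨ +[m+n]-+m≡+n (suc t ℕ.* ballot k t n) T ⟩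
  + T
    ≡⟨ cong +_ (sym (s≡trailingDowns k t n)) ⟩
  + s k t n ∎)
  where
  T : ℕ
  T = trailingDowns k (n + n ℕ.* k) t t n
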